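{- Let $\Omega = (\lambda x.x\,x)(\lambda x.x\,x)$. Then $\mathcal{S}k.\Omega \cong_1 \Omega$ (for a variable $k$).
   Context: The calculus $\lambda_S$: terms $t ::= v \mid t\,t \mid \mathcal{S}k.t \mid \langle t\rangle$, values $v ::= x \mid \lambda x.t$ (up to $\alpha$-conversion). Pure contexts $E ::= \square \mid v\,E \mid E\,t$; evaluation contexts $F ::= \square \mid v\,F \mid F\,t \mid \langle F\rangle$; contexts $C ::= \square \mid \lambda x.C \mid t\,C \mid C\,t \mid \mathcal{S}k.C \mid \langle C\rangle$. Reduction: $F[(\lambda x.t)\,v] \to F[t\{v/x\}]$; $F[\langle E[\mathcal{S}k.t]\rangle] \to F[\langle t\{\lambda x.\langle E[x]\rangle/k\}\rangle]$ ($x\notin\mathrm{fv}(E)$); $F[\langle v\rangle]\to F[v]$. A normal form is a value or a term that is not a value and does not reduce; $t\Downarrow t'$ means $t\to^* t'$ with $t'$ a normal form. For closed terms, $t_0 \cong_1 t_1$ iff for every closed context $C$: $C[t_0]\Downarrow v_0$ for some value $v_0$ iff $C[t_1]\Downarrow v_1$ for some value $v_1$. -}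

module Defs where

open import Data.Nat using (ℕ; zero; suc)
open import Data.Fin using (Fin; zero; suc)
open import Data.Product using (Σ; _×_; _,_)
open import Data.Sum using (_⊎_)
open import Relation.Nullary using (¬_)
open import Relation.Binary.Construct.Closure.ReflexiveTransitive using (Star)
open import Function.Bundles using (_⇔_)

-- Terms of λ_S, well-scoped de Bruijn syntax (terms up to α-conversion).
-- Tm n: terms with at most n free variables.
data Tm (n : ℕ) : Set where
  var   : Fin n → Tm n
  lam   : Tm (suc n) → Tm n
  app   : Tm n → Tm n → Tm n
  shift : Tm (suc n) → Tm n
  reset : Tm n → Tm n

data Val {n : ℕ} : Tm n → Set where
  var : (x : Fin n) → Val (var x)
  lam : (t : Tm (suc n)) → Val (lam t)

ext : ∀ {m n} → (Fin m → Fin n) → Fin (suc m) → Fin (suc n)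
ext ρ zero    = zero
ext ρ (suc x) = suc (ρ x)

ren : ∀ {m n} → (Fin m → Fin n) → Tm m → Tm n
ren ρ (var x)   = var (ρ x)
ren ρ (lam t)   = lam (ren (ext ρ) t)
ren ρ (app t u) = app (ren ρ t) (ren ρ u)
ren ρ (shift t) = shift (ren (ext ρ) t)
ren ρ (reset t) = reset (ren ρ t)

exts : ∀ {m n} → (Fin m → Tm n) → Fin (suc m) → Tm (suc n)
exts σ zero    = var zero
exts σ (suc x) = ren suc (σ x)

sub : ∀ {m n} → (Fin m → Tm n) → Tm m → Tm n
sub σ (var x)   = σ x
sub σ (lam t)   = lam (sub (exts σ) t)
sub σ (app t u) = app (sub σ t) (sub σ u)
sub σ (shift t) = shift (sub (exts σ) t)
sub σ (reset t) = reset (sub σ t)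

single : ∀ {n} → Tm n → Fin (suc n) → Tm n
single v zero    = v
single v (suc x) = var x

_[_] : ∀ {n} → Tm (suc n) → Tm n → Tm n
t [ v ] = sub (single v) t

data PCtx (n : ℕ) : Set where
  hole : PCtx n
  appR : (v : Tm n) → Val v → PCtx n → PCtx n
  appL : PCtx n → Tm n → PCtx n

plugE : ∀ {n} → PCtx n → Tm n → Tm n
plugE hole          t = t
plugE (appR v _ E)  t = app v (plugE E t)
plugE (appL E u)    t = app (plugE E t) u

renVal : ∀ {m n} (ρ : Fin m → Fin n) {v : Tm m} → Val v → Val (ren ρ v)
renVal ρ (var x) = var (ρ x)
renVal ρ (lam t) = lam (ren (ext ρ) t)

renE : ∀ {m n} → (Fin m → Fin n) → PCtx m → PCtx n
renE ρ hole           = hole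
renE ρ (appR v vv E)  = appR (ren ρ v) (renVal ρ vv) (renE ρ E)
renE ρ (appL E u)     = appL (renE ρ E) (ren ρ u)

data ECtx (n : ℕ) : Set where
  hole  : ECtx n
  appR  : (v : Tm n) → Val v → ECtx n → ECtx n
  appL  : ECtx n → Tm n → ECtx n
  reset : ECtx n → ECtx n

plugF : ∀ {n} → ECtx n → Tm n → Tm n
plugF hole          t = t
plugF (appR v _ F)  t = app v (plugF F t)
plugF (appL F u)    t = app (plugF F t) u
plugF (reset F)     t = reset (plugF F t)

data _⟶_ {n : ℕ} : Tm n → Tm n → Set where
  β     : (F : ECtx n) (t : Tm (suc n)) (v : Tm n) → Val v →
          plugF F (app (lam t) v) ⟶ plugF F (t [ v ])
  shft  : (F : ECtx n) (E : PCtx n) (t : Tm (suc n)) →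
          plugF F (reset (plugE E (shift t)))
            ⟶ plugF F (reset (t [ lam (reset (plugE (renE suc E) (var zero))) ]))
  rst   : (F : ECtx n) (v : Tm n) → Val v →
          plugF F (reset v) ⟶ plugF F v

_⟶*_ : ∀ {n} → Tm n → Tm n → Set
_⟶*_ = Star _⟶_

NormalForm : ∀ {n} → Tm n → Set
NormalForm t = Val t ⊎ (¬ Val t × (∀ t′ → ¬ (t ⟶ t′)))

_⇓_ : ∀ {n} → Tm n → Tm n → Set
t ⇓ t′ = (t ⟶* t′) × NormalForm t′

-- General contexts C ::= □ | λx.C | t C | C t | S k.C | ⟨C⟩,
-- indexed by the scope at the outside; the hole is filled with a closed term.
data Ctx (n : ℕ) : Set where
  hole  : Ctx n
  lam   : Ctx (suc n) → Ctx n
  appR  : Tm n → Ctx n → Ctx n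
  appL  : Ctx n → Tm n → Ctx n
  shift : Ctx (suc n) → Ctx n
  reset : Ctx n → Ctx n

weaken0 : ∀ {n} → Tm 0 → Tm n
weaken0 = ren (λ ())

plug : ∀ {n} → Ctx n → Tm 0 → Tm n
plug hole       t = weaken0 t
plug (lam C)    t = lam (plug C t)
plug (appR u C) t = app u (plug C t)
plug (appL C u) t = app (plug C t) u
plug (shift C)  t = shift (plug C t)
plug (reset C)  t = reset (plug C t)

_⇓val : Tm 0 → Set
t ⇓val = Σ (Tm 0) (λ v → (t ⇓ v) × Val v)

_≅₁_ : Tm 0 → Tm 0 → Set
t₀ ≅₁ t₁ = (C : Ctx 0) → (plug C t₀ ⇓val) ⇔ (plug C t₁ ⇓val)

ω : ∀ {n} → Tm n
ω = lam (app (var zero) (var zero))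

Ω : ∀ {n} → Tm n
Ω = app ω ω

module Submission where

open import Defs
open import Data.Nat using (ℕ; suc)
open import Data.Fin using (Fin; zero; suc)
open import Data.Product using (∃-syntax; _×_; _,_)
open import Data.Sum using (_⊎_; inj₁; inj₂)
open import Data.Empty using (⊥-elim)
open import Relation.Nullary using (¬_)
open import Relation.Binary.PropositionalEquality using (_≡_; _≢_; refl)
open import Relation.Binary.Construct.Closure.ReflexiveTransitive using (ε; _◅_; _◅◅_; gmap)
open import Function.Bundles using (mk⇔)

-- A term is doomed if it has the form F[Ω] or F[S k.Ω] for an evaluation
-- context F.  Doomed terms are not values, and every reduct of a doomed term is
-- doomed: Ω reduces only to itself, and S k.Ω capturing its pure context yields
-- ⟨Ω⟩.  Relating terms that agree up to exchanging doomed subterms gives a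
-- relation that is closed under value substitution and is a weak simulation
-- (each step on one side is matched by at most one step on the other), so
-- related closed terms converge to a value together.  The relation is closed
-- under contexts and relates S k.Ω to Ω.

private variable
  m n : ℕ

-- The equations in the first constructor let Doomed be inverted on terms such
-- as plugF F r whose head symbol is not yet known.
data Doomed {n : ℕ} : Tm n → Set where
  Ω-doomed      : {a b : Tm n} → a ≡ ω → b ≡ ω → Doomed (app a b)
  shiftΩ-doomed : Doomed (shift Ω)
  appL          : {t s : Tm n} → Doomed t → Doomed (app t s)
  appR          : {v t : Tm n} → Val v → Doomed t → Doomed (app v t)
  reset         : {t : Tm n} → Doomed t → Doomed (reset t)

Doomed-¬Val : {t : Tm n} → Doomed t → ¬ Val t
Doomed-¬Val (Ω-doomed _ _)    ()
Doomed-¬Val shiftΩ-doomed     ()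
Doomed-¬Val (appL _)          ()
Doomed-¬Val (appR _ _)        ()
Doomed-¬Val (reset _)         ()

Doomed-ren : (ρ : Fin m → Fin n) {t : Tm m} → Doomed t → Doomed (ren ρ t)
Doomed-ren ρ (Ω-doomed refl refl)  = Ω-doomed refl refl
Doomed-ren ρ shiftΩ-doomed         = shiftΩ-doomed
Doomed-ren ρ (appL d)              = appL (Doomed-ren ρ d)
Doomed-ren ρ (appR v d)            = appR (renVal ρ v) (Doomed-ren ρ d)
Doomed-ren ρ (reset d)             = reset (Doomed-ren ρ d)

ValSub : (Fin m → Tm n) → Set
ValSub σ = ∀ x → Val (σ x)

ValSub-exts : {σ : Fin m → Tm n} → ValSub σ → ValSub (exts σ)
ValSub-exts vσ zero    = var zero
ValSub-exts vσ (suc x) = renVal suc (vσ x)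

ValSub-single : {v : Tm n} → Val v → ValSub (single v)
ValSub-single vv zero    = vv
ValSub-single vv (suc x) = var x

Val-sub : {σ : Fin m → Tm n} → ValSub σ → {v : Tm m} → Val v → Val (sub σ v)
Val-sub vσ (var x)         = vσ x
Val-sub {σ = σ} vσ (lam t) = lam (sub (exts σ) t)

Doomed-sub : {σ : Fin m → Tm n} → ValSub σ → {t : Tm m} → Doomed t → Doomed (sub σ t)
Doomed-sub vσ (Ω-doomed refl refl)  = Ω-doomed refl refl
Doomed-sub vσ shiftΩ-doomed         = shiftΩ-doomed
Doomed-sub vσ (appL d)              = appL (Doomed-sub vσ d)
Doomed-sub vσ (appR v d)            = appR (Val-sub vσ v) (Doomed-sub vσ d)
Doomed-sub vσ (reset d)             = reset (Doomed-sub vσ d)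

infix 4 _~_ _~E_

data _~_ {n : ℕ} : Tm n → Tm n → Set where
  doomed : {t u : Tm n} → Doomed t → Doomed u → t ~ u
  var    : (x : Fin n) → var x ~ var x
  lam    : {t u : Tm (suc n)} → t ~ u → lam t ~ lam u
  app    : {t t′ u u′ : Tm n} → t ~ u → t′ ~ u′ → app t t′ ~ app u u′
  shift  : {t u : Tm (suc n)} → t ~ u → shift t ~ shift u
  reset  : {t u : Tm n} → t ~ u → reset t ~ reset u

~-refl : (t : Tm n) → t ~ t
~-refl (var x)   = var x
~-refl (lam t)   = lam (~-refl t)
~-refl (app t s) = app (~-refl t) (~-refl s)
~-refl (shift t) = shift (~-refl t)
~-refl (reset t) = reset (~-refl t)

~-Val : {t u : Tm n} → t ~ u → Val t → Val u
~-Val (doomed d _)    vt = ⊥-elim (Doomed-¬Val d vt)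
~-Val (var x)         _  = var x
~-Val (lam {u = u} _) _  = lam u

~-ren : (ρ : Fin m → Fin n) {t u : Tm m} → t ~ u → ren ρ t ~ ren ρ u
~-ren ρ (doomed d e) = doomed (Doomed-ren ρ d) (Doomed-ren ρ e)
~-ren ρ (var x)      = var (ρ x)
~-ren ρ (lam c)      = lam (~-ren (ext ρ) c)
~-ren ρ (app c c′)   = app (~-ren ρ c) (~-ren ρ c′)
~-ren ρ (shift c)    = shift (~-ren (ext ρ) c)
~-ren ρ (reset c)    = reset (~-ren ρ c)

_~ˢ_ : (σ τ : Fin m → Tm n) → Set
σ ~ˢ τ = ∀ x → σ x ~ τ x

~ˢ-exts : {σ τ : Fin m → Tm n} → σ ~ˢ τ → exts σ ~ˢ exts τ
~ˢ-exts r zero    = var zero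
~ˢ-exts r (suc x) = ~-ren suc (r x)

~-sub : {σ τ : Fin m → Tm n} → ValSub σ → ValSub τ → σ ~ˢ τ →
        {t u : Tm m} → t ~ u → sub σ t ~ sub τ u
~-sub vσ vτ r (doomed d e) = doomed (Doomed-sub vσ d) (Doomed-sub vτ e)
~-sub vσ vτ r (var x)      = r x
~-sub vσ vτ r (lam c)      = lam (~-sub (ValSub-exts vσ) (ValSub-exts vτ) (~ˢ-exts r) c)
~-sub vσ vτ r (app c c′)   = app (~-sub vσ vτ r c) (~-sub vσ vτ r c′)
~-sub vσ vτ r (shift c)    = shift (~-sub (ValSub-exts vσ) (ValSub-exts vτ) (~ˢ-exts r) c)
~-sub vσ vτ r (reset c)    = reset (~-sub vσ vτ r c)

~-[] : {t u : Tm (suc n)} {v w : Tm n} → Val v → Val w →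
       t ~ u → v ~ w → t [ v ] ~ u [ w ]
~-[] vv vw c cv = ~-sub (ValSub-single vv) (ValSub-single vw) single~ c
  where
  single~ : single _ ~ˢ single _
  single~ zero    = cv
  single~ (suc x) = var x

data _~E_ {n : ℕ} : PCtx n → PCtx n → Set where
  hole : hole ~E hole
  appR : {v w : Tm n} {E E′ : PCtx n} (vv : Val v) (vw : Val w) →
         v ~ w → E ~E E′ → appR v vv E ~E appR w vw E′
  appL : {E E′ : PCtx n} {s s′ : Tm n} → E ~E E′ → s ~ s′ → appL E s ~E appL E′ s′

~-plugE : {E E′ : PCtx n} {t u : Tm n} → E ~E E′ → t ~ u → plugE E t ~ plugE E′ u
~-plugE hole              c = c
~-plugE (appR _ _ cv cE)  c = app cv (~-plugE cE c)
~-plugE (appL cE cs)      c = app (~-plugE cE c) cs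

~E-renE : (ρ : Fin m → Fin n) {E E′ : PCtx m} → E ~E E′ → renE ρ E ~E renE ρ E′
~E-renE ρ hole              = hole
~E-renE ρ (appR _ _ cv cE)  = appR _ _ (~-ren ρ cv) (~E-renE ρ cE)
~E-renE ρ (appL cE cs)      = appL (~E-renE ρ cE) (~-ren ρ cs)

infix 4 _↦_

data _↦_ {n : ℕ} : Tm n → Tm n → Set where
  β    : (t : Tm (suc n)) {v : Tm n} → Val v → app (lam t) v ↦ t [ v ]
  shft : (E : PCtx n) (t : Tm (suc n)) →
         reset (plugE E (shift t)) ↦ reset (t [ lam (reset (plugE (renE suc E) (var zero))) ])
  rst  : {v : Tm n} → Val v → reset v ↦ v

↦-¬Val : {r r′ : Tm n} → r ↦ r′ → ¬ Val r
↦-¬Val (β _ _)    ()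
↦-¬Val (shft _ _) ()
↦-¬Val (rst _)    ()

Val-plugF : (F : ECtx n) {t : Tm n} → Val (plugF F t) → Val t
Val-plugF hole v = v

Val-plugE : (E : PCtx n) {t : Tm n} → Val (plugE E t) → Val t
Val-plugE hole v = v

plugE-shift-¬Val : (E : PCtx n) {t : Tm (suc n)} → ¬ Val (plugE E (shift t))
plugE-shift-¬Val E v with Val-plugE E v
... | ()

plugF-↦-¬Val : (F : ECtx n) {r r′ : Tm n} → r ↦ r′ → ¬ Val (plugF F r)
plugF-↦-¬Val F h v = ↦-¬Val h (Val-plugF F v)

¬Val⇒≢lam : {t : Tm n} {b : Tm (suc n)} → ¬ Val t → t ≢ lam b
¬Val⇒≢lam ¬v refl = ¬v (lam _)

Doomed-plugE-shift : (E : PCtx n) {t : Tm (suc n)} → Doomed (plugE E (shift t)) → t ≡ Ω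
Doomed-plugE-shift hole            shiftΩ-doomed = refl
Doomed-plugE-shift (appR _ _ E)    (Ω-doomed _ e) = ⊥-elim (¬Val⇒≢lam (plugE-shift-¬Val E) e)
Doomed-plugE-shift (appR _ vv E)   (appL d)       = ⊥-elim (Doomed-¬Val d vv)
Doomed-plugE-shift (appR _ _ E)    (appR _ d)     = Doomed-plugE-shift E d
Doomed-plugE-shift (appL E _)      (Ω-doomed e _) = ⊥-elim (¬Val⇒≢lam (plugE-shift-¬Val E) e)
Doomed-plugE-shift (appL E _)      (appL d)       = Doomed-plugE-shift E d
Doomed-plugE-shift (appL E _)      (appR vv _)    = ⊥-elim (plugE-shift-¬Val E vv)

Doomed-↦ : (F : ECtx n) {r r′ : Tm n} → r ↦ r′ → Doomed (plugF F r) → Doomed (plugF F r′)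
Doomed-↦ hole (β _ _)    (Ω-doomed refl refl) = Ω-doomed refl refl
Doomed-↦ hole (β _ vv)   (appR _ d)           = ⊥-elim (Doomed-¬Val d vv)
Doomed-↦ hole (shft E _) (reset d) with Doomed-plugE-shift E d
... | refl = reset (Ω-doomed refl refl)
Doomed-↦ hole (rst vv)   (reset d)            = ⊥-elim (Doomed-¬Val d vv)
Doomed-↦ (appR _ _ F) h  (Ω-doomed _ e)       = ⊥-elim (¬Val⇒≢lam (plugF-↦-¬Val F h) e)
Doomed-↦ (appR _ vv F) h (appL d)             = ⊥-elim (Doomed-¬Val d vv)
Doomed-↦ (appR _ _ F) h  (appR vv d)          = appR vv (Doomed-↦ F h d)
Doomed-↦ (appL F _) h    (Ω-doomed e _)       = ⊥-elim (¬Val⇒≢lam (plugF-↦-¬Val F h) e)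
Doomed-↦ (appL F _) h    (appL d)             = appL (Doomed-↦ F h d)
Doomed-↦ (appL F _) h    (appR vv _)          = ⊥-elim (plugF-↦-¬Val F h vv)
Doomed-↦ (reset F) h     (reset d)            = reset (Doomed-↦ F h d)

⟶-appL : {t t′ : Tm n} (s : Tm n) → t ⟶ t′ → app t s ⟶ app t′ s
⟶-appL s (β F t v vv)  = β (appL F s) t v vv
⟶-appL s (shft F E t)  = shft (appL F s) E t
⟶-appL s (rst F v vv)  = rst (appL F s) v vv

⟶-appR : {w t t′ : Tm n} (vw : Val w) → t ⟶ t′ → app w t ⟶ app w t′
⟶-appR vw (β F t v vv) = β (appR _ vw F) t v vv
⟶-appR vw (shft F E t) = shft (appR _ vw F) E t
⟶-appR vw (rst F v vv) = rst (appR _ vw F) v vv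

⟶-reset : {t t′ : Tm n} → t ⟶ t′ → reset t ⟶ reset t′
⟶-reset (β F t v vv)   = β (reset F) t v vv
⟶-reset (shft F E t)   = shft (reset F) E t
⟶-reset (rst F v vv)   = rst (reset F) v vv

~-plugE-shift : (E : PCtx n) {t : Tm (suc n)} {u : Tm n} → plugE E (shift t) ~ u →
                (t ≡ Ω × Doomed u) ⊎
                ∃[ E′ ] ∃[ t′ ] (u ≡ plugE E′ (shift t′) × E ~E E′ × t ~ t′)
~-plugE-shift hole           (doomed d e) = inj₁ (Doomed-plugE-shift hole d , e)
~-plugE-shift E@(appR _ _ _) (doomed d e) = inj₁ (Doomed-plugE-shift E d , e)
~-plugE-shift E@(appL _ _)   (doomed d e) = inj₁ (Doomed-plugE-shift E d , e)
~-plugE-shift hole (shift c) = inj₂ (hole , _ , refl , hole , c)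
~-plugE-shift (appR _ vv E) (app cv c) with ~-plugE-shift E c
... | inj₁ (t≡Ω , e) = inj₁ (t≡Ω , appR (~-Val cv vv) e)
... | inj₂ (E′ , _ , refl , cE , ct) =
  inj₂ (appR _ (~-Val cv vv) E′ , _ , refl , appR vv _ cv cE , ct)
~-plugE-shift (appL E _) (app c cs) with ~-plugE-shift E c
... | inj₁ (t≡Ω , e) = inj₁ (t≡Ω , appL e)
... | inj₂ (E′ , _ , refl , cE , ct) = inj₂ (appL E′ _ , _ , refl , appL cE cs , ct)

~-simulates-↦ : (F : ECtx n) {r r′ u : Tm n} → r ↦ r′ → plugF F r ~ u →
                ∃[ u′ ] (u ⟶* u′ × plugF F r′ ~ u′)
~-simulates-↦ hole           h (doomed d e) = _ , ε , doomed (Doomed-↦ hole h d) e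
~-simulates-↦ F@(appR _ _ _) h (doomed d e) = _ , ε , doomed (Doomed-↦ F h d) e
~-simulates-↦ F@(appL _ _)   h (doomed d e) = _ , ε , doomed (Doomed-↦ F h d) e
~-simulates-↦ F@(reset _)    h (doomed d e) = _ , ε , doomed (Doomed-↦ F h d) e
~-simulates-↦ hole (β t vv) (app (lam {u = t′} c) cv) =
  _ , β hole t′ _ (~-Val cv vv) ◅ ε , ~-[] vv (~-Val cv vv) c cv
~-simulates-↦ hole (shft E t) (reset c) with ~-plugE-shift E c
... | inj₁ (refl , e) = _ , ε , doomed (reset (Ω-doomed refl refl)) (reset e)
... | inj₂ (E′ , t′ , refl , cE , ct) =
  _ , shft hole E′ t′ ◅ ε ,
  reset (~-[] (lam _) (lam _) ct (lam (reset (~-plugE (~E-renE suc cE) (var zero)))))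
~-simulates-↦ hole (rst vv) (reset c) = _ , rst hole _ (~-Val c vv) ◅ ε , c
~-simulates-↦ (appR _ vv F) h (app cv c) with ~-simulates-↦ F h c
... | _ , st , c′ = _ , gmap _ (⟶-appR (~-Val cv vv)) st , app cv c′
~-simulates-↦ (appL F _) h (app c cs) with ~-simulates-↦ F h c
... | _ , st , c′ = _ , gmap _ (⟶-appL _) st , app c′ cs
~-simulates-↦ (reset F) h (reset c) with ~-simulates-↦ F h c
... | _ , st , c′ = _ , gmap _ ⟶-reset st , reset c′

~-simulates-⟶ : {t t′ u : Tm n} → t ⟶ t′ → t ~ u → ∃[ u′ ] (u ⟶* u′ × t′ ~ u′)
~-simulates-⟶ (β F t _ vv)  = ~-simulates-↦ F (β t vv)
~-simulates-⟶ (shft F E t)  = ~-simulates-↦ F (shft E t)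
~-simulates-⟶ (rst F _ vv)  = ~-simulates-↦ F (rst vv)

~-reaches-Val : {t u v : Tm n} → t ~ u → t ⟶* v → Val v → ∃[ w ] (u ⟶* w × Val w)
~-reaches-Val c ε        vv = _ , ε , ~-Val c vv
~-reaches-Val c (s ◅ ss) vv with ~-simulates-⟶ s c
... | _ , st , c′ with ~-reaches-Val c′ ss vv
... | w , st′ , vw = w , st ◅◅ st′ , vw

~-⇓val : {t u : Tm 0} → t ~ u → t ⇓val → u ⇓val
~-⇓val c (_ , (st , _) , vv) with ~-reaches-Val c st vv
... | w , st′ , vw = w , (st′ , inj₁ vw) , vw

~-plug : (C : Ctx n) {t u : Tm 0} → t ~ u → plug C t ~ plug C u
~-plug hole       c = ~-ren (λ ()) c
~-plug (lam C)    c = lam (~-plug C c)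
~-plug (appR s C) c = app (~-refl s) (~-plug C c)
~-plug (appL C s) c = app (~-plug C c) (~-refl s)
~-plug (shift C)  c = shift (~-plug C c)
~-plug (reset C)  c = reset (~-plug C c)

Doomed⇒≅₁ : {t u : Tm 0} → Doomed t → Doomed u → t ≅₁ u
Doomed⇒≅₁ d e C = mk⇔ (~-⇓val (~-plug C (doomed d e))) (~-⇓val (~-plug C (doomed e d)))

proposition3p4 : shift Ω ≅₁ Ω
proposition3p4 = Doomed⇒≅₁ shiftΩ-doomed (Ω-doomed refl refl)
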